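{- Let $k\ge 3$ and $1\le \ell\le k-1$ be integers. If $C$ is a $k$-uniform $\ell$-cycle or a $k$-uniform $\ell$-path on $n$ vertices, then there exists a partition $\mathcal{P}$ of $V(C)$ into sets each of size $\lfloor \frac{k}{k-\ell}\rfloor(k-\ell)$, together with possibly one smaller set, such that for each $S \in \mathcal{P}$ there is an edge $e \in E(C)$ with $S \subseteq e$.
   Context: For $1\leq \ell\leq k-1$, a $k$-uniform $\ell$-path (respectively $\ell$-cycle) is a $k$-uniform hypergraph with no isolated vertices whose vertices are linearly (respectively cyclically) ordered so that every edge consists of $k$ consecutive vertices and any two consecutive edges intersect in exactly $\ell$ vertices. -}

module Defs where

open import Data.Nat using (ℕ; zero; suc; _+_; _*_; _∸_; _≤_; _<_; _/_; _≤ᵇ_; _<ᵇ_)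
open import Data.Bool using (Bool; _∧_; _∨_)
open import Data.Fin using (Fin; toℕ)
open import Data.Fin.Subset using (Subset; _∈_; _⊆_; _∩_; ∣_∣; Empty)
open import Data.Fin.Permutation using (Permutation′; _⟨$⟩ˡ_)
open import Data.Vec using (tabulate)
open import Data.List using (List; []; _∷_; map; length; _++_)
import Data.List.Membership.Propositional as LM
open import Data.List.Relation.Unary.All using (All)
open import Data.List.Relation.Unary.Linked using (Linked)
open import Data.List.Relation.Unary.AllPairs using (AllPairs)
open import Data.Product using (Σ; _×_; ∃)
open import Data.Unit using (⊤)
open import Relation.Binary.PropositionalEquality using (_≡_)

-- A vertex ordering is a permutation π, where π ⟨$⟩ʳ p is the vertex at
-- position p and π ⟨$⟩ˡ v is the position of vertex v.

linearBlock : ∀ {n} → Permutation′ n → (k s : ℕ) → Subset n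
linearBlock π k s = tabulate λ v →
  let p = toℕ (π ⟨$⟩ˡ v) in (s ≤ᵇ p) ∧ (p <ᵇ s + k)

-- The set of k cyclically consecutive vertices (in the cyclic order π on n
-- vertices) starting at position s (s < n, k ≤ n): positions s, s+1, …, s+k-1 mod n.
cyclicBlock : ∀ {n} → Permutation′ n → (k s : ℕ) → Subset n
cyclicBlock {n} π k s = tabulate λ v →
  let p = toℕ (π ⟨$⟩ˡ v) in ((s ≤ᵇ p) ∧ (p <ᵇ s + k)) ∨ (p + n <ᵇ s + k)

lastOf : ∀ {A : Set} → A → List A → A
lastOf x [] = x
lastOf x (y ∷ ys) = lastOf y ys

ConsecutiveMeet : ∀ {n} → ℕ → List (Subset n) → Set
ConsecutiveMeet ℓ es = Linked (λ a b → ∣ a ∩ b ∣ ≡ ℓ) es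

WrapMeet : ∀ {n} → ℕ → List (Subset n) → Set
WrapMeet ℓ [] = ⊤
WrapMeet ℓ (e ∷ es) = ∣ lastOf e es ∩ e ∣ ≡ ℓ

SameEdges : ∀ {n} → List (Subset n) → List (Subset n) → Set
SameEdges E F = (∀ e → e LM.∈ E → e LM.∈ F) × (∀ e → e LM.∈ F → e LM.∈ E)

NoIsolated : ∀ {n} → List (Subset n) → Set
NoIsolated {n} E = ∀ (v : Fin n) → Σ (Subset n) λ e → e LM.∈ E × v ∈ e

-- E is (the edge set of) a k-uniform ℓ-path on vertex set Fin n: there is a
-- linear ordering π of the vertices and edges e_1,…,e_m, listed in the order
-- of the path (strictly increasing start positions), each consisting of k
-- consecutive vertices, consecutive edges meeting in exactly ℓ vertices,
-- and no isolated vertices.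
IsLPath : (k ℓ n : ℕ) → List (Subset n) → Set
IsLPath k ℓ n E =
  Σ (Permutation′ n) λ π → Σ (List ℕ) λ starts →
    let es = map (linearBlock π k) starts in
    Linked _<_ starts × All (λ s → s + k ≤ n) starts ×
    ConsecutiveMeet ℓ es × SameEdges E es × NoIsolated E

IsLCycle : (k ℓ n : ℕ) → List (Subset n) → Set
IsLCycle k ℓ n E =
  Σ (Permutation′ n) λ π → Σ (List ℕ) λ starts →
    let es = map (cyclicBlock π k) starts in
    k ≤ n × Linked _<_ starts × All (λ s → s < n) starts ×
    ConsecutiveMeet ℓ es × WrapMeet ℓ es × SameEdges E es × NoIsolated E

-- ⌊k/(k-ℓ)⌋(k-ℓ)  (only used when ℓ < k, so k ∸ ℓ ≠ 0)
blockSize : ℕ → ℕ → ℕ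
blockSize k ℓ with k ∸ ℓ
... | zero = 0
... | suc d = (k / suc d) * suc d

Disjoint : ∀ {n} → Subset n → Subset n → Set
Disjoint a b = Empty (a ∩ b)

IsPartitionInto : ∀ {n} → ℕ → List (Subset n) → Set
IsPartitionInto {n} q P =
  AllPairs Disjoint P × (∀ (v : Fin n) → Σ (Subset n) λ S → S LM.∈ P × v ∈ S) ×
  Σ (List (Subset n)) λ full → Σ (List (Subset n)) λ rest →
    P ≡ full ++ rest × All (λ S → ∣ S ∣ ≡ q) full ×
    length rest ≤ 1 × All (λ S → 0 < ∣ S ∣ × ∣ S ∣ < q) rest

-- Order the vertices along the path or cycle and let d = k ∸ ℓ. Two windows of k consecutive vertices
-- meeting in ℓ vertices start d apart, or on a cycle possibly n ∸ d apart, and unless the cycle has exactly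
-- n = k + d vertices this forces the edges to start at x, x + d, x + 2d, … (with d ∣ n for a cycle). The
-- parts are then the runs of q = t d consecutive vertices from x, for any t ≥ 1 with t d ≤ k (here t = ⌊k/d⌋):
-- the run starting at x + j q = x + (j t) d lies in the edge starting there, except on a path after the last
-- start, where the last edge reaches the end. When n = k + d two consecutive edges cover the whole cycle.

module Submission where

open import Data.Nat using (ℕ; zero; suc; _+_; _*_; _∸_; _⊓_; _/_; _%_; _≤_; _<_; _≤ᵇ_; _<ᵇ_;
  z≤n; s≤s; z<s; NonZero; >-nonZero; >-nonZero⁻¹; ≢-nonZero⁻¹)
open import Data.Nat.Properties
open import Data.Nat.DivMod using (m≡m%n+[m/n]*n; m%n<n; m/n*n≤m; m%n≡m∸m/n*n; m<n*o⇒m/o<n; m≥n⇒m/n>0)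
open import Data.Nat.Tactic.RingSolver using (solve-∀)
open import Algebra.Properties.CommutativeSemigroup +-commutativeSemigroup using (xy∙z≈xz∙y)
open import Algebra.Properties.CommutativeMonoid.Sum +-0-commutativeMonoid using (sum; sum-permute; sum-cong-≗)
open import Data.Bool using (Bool; true; false; _∧_; _∨_; if_then_else_)
open import Data.Bool.Properties using (T-≡; ∨-identityʳ; ∧-zeroʳ)
open import Data.Empty using (⊥; ⊥-elim)
open import Data.Fin using (Fin; zero; suc; toℕ; fromℕ<)
open import Data.Fin.Properties using (toℕ<n; toℕ-fromℕ<)
open import Data.Fin.Subset using (Subset; _⊆_; _∩_; ∣_∣) renaming (_∈_ to _∈ˢ_)
open import Data.Fin.Subset.Properties using (x∈p∩q⁻; ∩-comm)
open import Data.Fin.Permutation using (Permutation′; _⟨$⟩ˡ_; _⟨$⟩ʳ_; inverseˡ)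
open import Data.Vec using (tabulate; _∷_)
open import Data.Vec.Properties using (tabulate-cong; []=⇒lookup; lookup⇒[]=; lookup∘tabulate)
open import Data.List using (List; []; _∷_; _++_; map; length; applyUpTo)
open import Data.List.Properties using (length-applyUpTo)
open import Data.List.Membership.Propositional using (_∈_)
open import Data.List.Membership.Propositional.Properties using (∈-map⁺; ∈-map⁻; ∈-applyUpTo⁺; ∈-applyUpTo⁻)
open import Data.List.Relation.Unary.Any using (here; there)
open import Data.List.Relation.Unary.All as All using (All; []; _∷_)
import Data.List.Relation.Unary.All.Properties as All
import Data.List.Relation.Unary.AllPairs.Properties as AllPairs
open import Data.List.Relation.Unary.Linked using (Linked; []; [-]; _∷_)
import Data.List.Relation.Unary.Linked.Properties as Linked
open import Data.Product using (Σ; _×_; _,_; proj₁; proj₂)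
open import Data.Sum using (_⊎_; inj₁; inj₂; [_,_]′)
open import Function using (_∘_)
open import Function.Bundles using (Equivalence)
open import Relation.Nullary using (yes; no; contradiction)
open import Relation.Binary.Definitions using (tri<; tri≈; tri>)
open import Relation.Binary.PropositionalEquality
open import Defs

<ᵇ-true : ∀ {m n} → m < n → (m <ᵇ n) ≡ true
<ᵇ-true m<n = Equivalence.to T-≡ (<⇒<ᵇ m<n)

<ᵇ-true⁻¹ : ∀ {m n} → (m <ᵇ n) ≡ true → m < n
<ᵇ-true⁻¹ {m} {n} e = <ᵇ⇒< m n (Equivalence.from T-≡ e)

<ᵇ-false : ∀ {m n} → n ≤ m → (m <ᵇ n) ≡ false
<ᵇ-false {m} {n} n≤m with m <ᵇ n in eq
... | false = refl
... | true  = contradiction (<ᵇ-true⁻¹ eq) (≤⇒≯ n≤m)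

≤ᵇ-true : ∀ {m n} → m ≤ n → (m ≤ᵇ n) ≡ true
≤ᵇ-true m≤n = Equivalence.to T-≡ (≤⇒≤ᵇ m≤n)

≤ᵇ-true⁻¹ : ∀ {m n} → (m ≤ᵇ n) ≡ true → m ≤ n
≤ᵇ-true⁻¹ {m} {n} e = ≤ᵇ⇒≤ m n (Equivalence.from T-≡ e)

≤ᵇ-false : ∀ {m n} → n < m → (m ≤ᵇ n) ≡ false
≤ᵇ-false {m} {n} n<m with m ≤ᵇ n in eq
... | false = refl
... | true  = contradiction (≤ᵇ-true⁻¹ eq) (<⇒≱ n<m)

∧-true⁻¹ : ∀ {a b} → a ∧ b ≡ true → a ≡ true × b ≡ true
∧-true⁻¹ {true} {true} _ = refl , refl

+-<ᵇ-+ : ∀ s a k → (s + a <ᵇ s + k) ≡ (a <ᵇ k)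
+-<ᵇ-+ zero    a k = refl
+-<ᵇ-+ (suc s) a k = +-<ᵇ-+ s a k

<ᵇ-∸ : ∀ {s y} k → s ≤ y → (y <ᵇ s + k) ≡ (y ∸ s <ᵇ k)
<ᵇ-∸ {s} {y} k s≤y =
  trans (cong (_<ᵇ s + k) (sym (m+[n∸m]≡n s≤y))) (+-<ᵇ-+ s (y ∸ s) k)

-- Offsets on a cycle

-- offset n o x : the position of x on a cycle of length n when positions are counted from o.
offset : ℕ → ℕ → ℕ → ℕ
offset n o x = if o ≤ᵇ x then x ∸ o else x + n ∸ o

IsOffset : ℕ → ℕ → ℕ → ℕ → Set
IsOffset n r o x = r + o ≡ x ⊎ r + o ≡ x + n

offset-≥ : ∀ n {o x} → o ≤ x → offset n o x ≡ x ∸ o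
offset-≥ n o≤x rewrite ≤ᵇ-true o≤x = refl

offset-< : ∀ n {o x} → x < o → offset n o x ≡ x + n ∸ o
offset-< n x<o rewrite ≤ᵇ-false x<o = refl

offset-isOffset : ∀ n o x → o ≤ n → IsOffset n (offset n o x) o x
offset-isOffset n o x o≤n with o ≤? x
... | yes o≤x = inj₁ (trans (cong (_+ o) (offset-≥ n o≤x)) (m∸n+n≡m o≤x))
... | no  o≰x = inj₂ (trans (cong (_+ o) (offset-< n (≰⇒> o≰x))) (m∸n+n≡m (≤-trans o≤n (m≤n+m n x))))

offset<n : ∀ n o x → o ≤ n → x < n → offset n o x < n
offset<n n o x o≤n x<n with o ≤? x
... | yes o≤x rewrite offset-≥ n o≤x = ≤-<-trans (m∸n≤m x o) x<n
... | no  o≰x rewrite offset-< n (≰⇒> o≰x) =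
  +-cancelʳ-< o (x + n ∸ o) n
    (subst (_< n + o) (sym (m∸n+n≡m (≤-trans o≤n (m≤n+m n x))))
      (subst (_< n + o) (+-comm n x) (+-monoʳ-< n (≰⇒> o≰x))))

private
  m<n⇒m≢o+n : ∀ {m n} → m < n → ∀ o → m ≢ o + n
  m<n⇒m≢o+n m<n a e = <⇒≱ m<n (subst (_ ≤_) (sym e) (m≤n+m _ a))

isOffset-unique : ∀ n {r r' o x} → r < n → r' < n → IsOffset n r o x → IsOffset n r' o x → r ≡ r'
isOffset-unique n {r} {r'} {o} _ _ (inj₁ e) (inj₁ e') = +-cancelʳ-≡ o r r' (trans e (sym e'))
isOffset-unique n {r} {r'} {o} _ r'<n (inj₁ e) (inj₂ e') =
  contradiction (+-cancelʳ-≡ o _ _ (trans e' (trans (cong (_+ n) (sym e)) (xy∙z≈xz∙y r o n)))) (m<n⇒m≢o+n r'<n r)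
isOffset-unique n {r} {r'} {o} r<n _ (inj₂ e) (inj₁ e') =
  contradiction (+-cancelʳ-≡ o _ _ (trans e (trans (cong (_+ n) (sym e')) (xy∙z≈xz∙y r' o n)))) (m<n⇒m≢o+n r<n r')
isOffset-unique n {r} {r'} {o} _ _ (inj₂ e) (inj₂ e') = +-cancelʳ-≡ o r r' (trans e (sym e'))

-- (x − s) ≡ (x − o) − (s − o) modulo n.
isOffset-relative : ∀ n {d t X s o x} → d < n → t < n → X < n →
  IsOffset n d s x → IsOffset n t o s → IsOffset n X o x → IsOffset n d t X
isOffset-relative n {d} {t} {X} {s} {o} {x} d<n t<n X<n = go
  where
  cancel : ∀ {a b} → a + o ≡ b + o → a ≡ b
  cancel = +-cancelʳ-≡ o _ _
  go : IsOffset n d s x → IsOffset n t o s → IsOffset n X o x → IsOffset n d t X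
  go (inj₁ a) (inj₁ b) (inj₁ c) = inj₁ (cancel (trans (+-assoc d t o) (trans (cong (d +_) b) (trans a (sym c)))))
  go (inj₁ a) (inj₁ b) (inj₂ c) = contradiction (cancel
       (trans c (trans (cong (_+ n) (sym (trans (+-assoc d t o) (trans (cong (d +_) b) a)))) (xy∙z≈xz∙y (d + t) o n))))
       (m<n⇒m≢o+n X<n (d + t))
  go (inj₁ a) (inj₂ b) (inj₁ c) = inj₂ (cancel (trans (+-assoc d t o) (trans (cong (d +_) b)
       (trans (sym (+-assoc d s n)) (trans (cong (_+ n) (trans a (sym c))) (xy∙z≈xz∙y X o n))))))
  go (inj₁ a) (inj₂ b) (inj₂ c) = inj₁ (cancel (trans (+-assoc d t o) (trans (cong (d +_) b)
       (trans (sym (+-assoc d s n)) (trans (cong (_+ n) a) (sym c))))))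
  go (inj₂ a) (inj₁ b) (inj₁ c) = inj₂ (cancel (trans (+-assoc d t o) (trans (cong (d +_) b)
       (trans a (trans (cong (_+ n) (sym c)) (xy∙z≈xz∙y X o n))))))
  go (inj₂ a) (inj₁ b) (inj₂ c) = inj₁ (cancel (trans (+-assoc d t o) (trans (cong (d +_) b) (trans a (sym c)))))
  go (inj₂ a) (inj₂ b) (inj₁ c) = contradiction (subst (n + n ≤_) (sym d+t≡X+2n) (m≤n+m (n + n) X))
                                                 (<⇒≱ (+-mono-< d<n t<n))
    where
    d+t≡X+2n : d + t ≡ X + (n + n)
    d+t≡X+2n = cancel (trans (+-assoc d t o) (trans (cong (d +_) b) (trans (sym (+-assoc d s n))
      (trans (cong (_+ n) a) (trans (cong (λ z → z + n + n) (sym c)) (rearrange X o n))))))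
      where rearrange : ∀ a b c → a + b + c + c ≡ a + (c + c) + b
            rearrange = solve-∀
  go (inj₂ a) (inj₂ b) (inj₂ c) = inj₂ (cancel (trans (+-assoc d t o) (trans (cong (d +_) b)
       (trans (sym (+-assoc d s n)) (trans (cong (_+ n) a) (trans (cong (_+ n) (sym c)) (xy∙z≈xz∙y X o n)))))))

offset-relative : ∀ n o s x → o ≤ n → s < n → x < n →
  offset n (offset n o s) (offset n o x) ≡ offset n s x
offset-relative n o s x o≤n s<n x<n =
  isOffset-unique n (offset<n n t X (<⇒≤ t<n) X<n) (offset<n n s x (<⇒≤ s<n) x<n)
    (offset-isOffset n t X (<⇒≤ t<n))
    (isOffset-relative n (offset<n n s x (<⇒≤ s<n) x<n) t<n X<n
      (offset-isOffset n s x (<⇒≤ s<n)) (offset-isOffset n o s o≤n) (offset-isOffset n o x o≤n))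
  where
  t = offset n o s
  X = offset n o x
  t<n = offset<n n o s o≤n s<n
  X<n = offset<n n o x o≤n x<n

offset-surjective : ∀ n {o r} → o < n → r < n → Σ ℕ λ x → x < n × offset n o x ≡ r
offset-surjective n {o} {r} o<n r<n with r + o <? n
... | yes r+o<n = r + o , r+o<n ,
  isOffset-unique n (offset<n n o (r + o) (<⇒≤ o<n) r+o<n) r<n (offset-isOffset n o (r + o) (<⇒≤ o<n)) (inj₁ refl)
... | no r+o≮n = x , x<n ,
  isOffset-unique n (offset<n n o x (<⇒≤ o<n) x<n) r<n (offset-isOffset n o x (<⇒≤ o<n)) (inj₂ (sym (m∸n+n≡m n≤r+o)))
  where
  n≤r+o = ≮⇒≥ r+o≮n
  x = r + o ∸ n
  x<n : x < n
  x<n = +-cancelʳ-< n x n (subst (_< n + n) (sym (m∸n+n≡m n≤r+o)) (+-mono-< r<n o<n))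

-- cyclicBlock π k s is tabulate (cyclicWindowᵇ n k s ∘ position π) by definition.
cyclicWindowᵇ : ℕ → ℕ → ℕ → ℕ → Bool
cyclicWindowᵇ n k s x = ((s ≤ᵇ x) ∧ (x <ᵇ s + k)) ∨ (x + n <ᵇ s + k)

cyclicWindowᵇ-offset : ∀ n k s x → k ≤ n → s ≤ n → x < n → cyclicWindowᵇ n k s x ≡ (offset n s x <ᵇ k)
cyclicWindowᵇ-offset n k s x k≤n s≤n x<n with s ≤? x
... | yes s≤x = begin
  ((s ≤ᵇ x) ∧ (x <ᵇ s + k)) ∨ (x + n <ᵇ s + k)
    ≡⟨ cong₂ (λ a b → (a ∧ (x <ᵇ s + k)) ∨ b) (≤ᵇ-true s≤x) (<ᵇ-false (+-mono-≤ s≤x k≤n)) ⟩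
  (x <ᵇ s + k) ∨ false                        ≡⟨ ∨-identityʳ _ ⟩
  (x <ᵇ s + k)                                ≡⟨ <ᵇ-∸ k s≤x ⟩
  (x ∸ s <ᵇ k)                                ≡⟨ cong (_<ᵇ k) (sym (offset-≥ n s≤x)) ⟩
  (offset n s x <ᵇ k)                         ∎
  where open ≡-Reasoning
... | no s≰x = begin
  ((s ≤ᵇ x) ∧ (x <ᵇ s + k)) ∨ (x + n <ᵇ s + k)
    ≡⟨ cong (λ a → (a ∧ (x <ᵇ s + k)) ∨ (x + n <ᵇ s + k)) (≤ᵇ-false (≰⇒> s≰x)) ⟩
  (x + n <ᵇ s + k)                            ≡⟨ <ᵇ-∸ k (≤-trans s≤n (m≤n+m n x)) ⟩
  (x + n ∸ s <ᵇ k)                            ≡⟨ cong (_<ᵇ k) (sym (offset-< n (≰⇒> s≰x))) ⟩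
  (offset n s x <ᵇ k)                         ∎
  where open ≡-Reasoning

-- Counting vertices by position

indicator : Bool → ℕ
indicator true  = 1
indicator false = 0

count : (ℕ → Bool) → ℕ → ℕ → ℕ
count P a zero    = 0
count P a (suc l) = indicator (P a) + count P (suc a) l

∣tabulate∣≡sum : ∀ {n} (f : Fin n → Bool) → ∣ tabulate f ∣ ≡ sum (indicator ∘ f)
∣tabulate∣≡sum {zero}  f = refl
∣tabulate∣≡sum {suc n} f with f zero
... | true  = cong suc (∣tabulate∣≡sum (λ i → f (suc i)))
... | false = ∣tabulate∣≡sum (λ i → f (suc i))

∣tabulate∘π∣ : ∀ {n} (π : Permutation′ n) (f : Fin n → Bool) →
  ∣ tabulate (λ v → f (π ⟨$⟩ˡ v)) ∣ ≡ ∣ tabulate f ∣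
∣tabulate∘π∣ {n} π f = begin
  ∣ tabulate (λ v → f (π ⟨$⟩ˡ v)) ∣                  ≡⟨ ∣tabulate∣≡sum (λ v → f (π ⟨$⟩ˡ v)) ⟩
  sum (λ v → indicator (f (π ⟨$⟩ˡ v)))              ≡⟨ sum-permute (λ v → indicator (f (π ⟨$⟩ˡ v))) π ⟩
  sum (λ v → indicator (f (π ⟨$⟩ˡ (π ⟨$⟩ʳ v))))
    ≡⟨ sum-cong-≗ {n} (λ v → cong (indicator ∘ f) (inverseˡ π)) ⟩
  sum (indicator ∘ f)                               ≡⟨ ∣tabulate∣≡sum f ⟨
  ∣ tabulate f ∣                                    ∎
  where open ≡-Reasoning

sum≡count : ∀ n (P : ℕ → Bool) a → sum {n} (λ i → indicator (P (a + toℕ i))) ≡ count P a n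
sum≡count zero    P a = refl
sum≡count (suc n) P a = cong₂ _+_ (cong (indicator ∘ P) (+-identityʳ a))
  (trans (sum-cong-≗ {n} (λ i → cong (indicator ∘ P) (+-suc a (toℕ i)))) (sum≡count n P (suc a)))

position : ∀ {n} → Permutation′ n → Fin n → ℕ
position π v = toℕ (π ⟨$⟩ˡ v)

vertexAt : ∀ {n} → Permutation′ n → ∀ p → p < n → Fin n
vertexAt π p p<n = π ⟨$⟩ʳ fromℕ< p<n

position-vertexAt : ∀ {n} (π : Permutation′ n) p (p<n : p < n) → position π (vertexAt π p p<n) ≡ p
position-vertexAt π p p<n = trans (cong toℕ (inverseˡ π)) (toℕ-fromℕ< p<n)

∣tabulate∘position∣ : ∀ {n} (π : Permutation′ n) (P : ℕ → Bool) → ∣ tabulate (P ∘ position π) ∣ ≡ count P 0 n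
∣tabulate∘position∣ {n} π P =
  trans (∣tabulate∘π∣ π (P ∘ toℕ)) (trans (∣tabulate∣≡sum {n} (P ∘ toℕ)) (sum≡count n P 0))

count-cong : ∀ P Q a b l → (∀ i → i < l → P (a + i) ≡ Q (b + i)) → count P a l ≡ count Q b l
count-cong P Q a b zero    P≡Q = refl
count-cong P Q a b (suc l) P≡Q =
  cong₂ _+_ (cong indicator (trans (cong P (sym (+-identityʳ a))) (trans (P≡Q 0 (s≤s z≤n)) (cong Q (+-identityʳ b)))))
    (count-cong P Q (suc a) (suc b) l
      (λ i i<l → trans (cong P (sym (+-suc a i))) (trans (P≡Q (suc i) (s≤s i<l)) (cong Q (+-suc b i)))))

count-+ : ∀ P a l₁ l₂ → count P a (l₁ + l₂) ≡ count P a l₁ + count P (a + l₁) l₂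
count-+ P a zero     l₂ = cong (λ z → count P z l₂) (sym (+-identityʳ a))
count-+ P a (suc l₁) l₂ = trans (cong (indicator (P a) +_) (trans (count-+ P (suc a) l₁ l₂)
    (cong (λ z → count P (suc a) l₁ + count P z l₂) (sym (+-suc a l₁)))))
  (sym (+-assoc (indicator (P a)) _ _))

count-<ᵇ : ∀ c a l → count (_<ᵇ c) a l ≡ (c ∸ a) ⊓ l
count-<ᵇ c a zero = sym (⊓-zeroʳ (c ∸ a))
count-<ᵇ c a (suc l) with a <? c
... | yes a<c rewrite <ᵇ-true a<c | count-<ᵇ c (suc a) l | +-∸-assoc 1 a<c = refl
... | no  a≮c rewrite <ᵇ-false {a} {c} (≮⇒≥ a≮c) | count-<ᵇ c (suc a) l
        | m≤n⇒m∸n≡0 (≮⇒≥ a≮c) | m≤n⇒m∸n≡0 (≤-trans (≮⇒≥ a≮c) (n≤1+n a)) = refl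

count-offset : ∀ n o F → o ≤ n → count (F ∘ offset n o) 0 n ≡ count F 0 n
count-offset n o F o≤n = begin
  count G 0 n                                 ≡⟨ cong (count G 0) (sym (m+[n∸m]≡n o≤n)) ⟩
  count G 0 (o + (n ∸ o))                     ≡⟨ count-+ G 0 o (n ∸ o) ⟩
  count G 0 o + count G o (n ∸ o)
    ≡⟨ cong₂ _+_ (count-cong G F 0 (n ∸ o) o wrapped) (count-cong G F o 0 (n ∸ o) shifted) ⟩
  count F (n ∸ o) o + count F 0 (n ∸ o)       ≡⟨ +-comm (count F (n ∸ o) o) _ ⟩
  count F 0 (n ∸ o) + count F (n ∸ o) o       ≡⟨ count-+ F 0 (n ∸ o) o ⟨
  count F 0 (n ∸ o + o)                       ≡⟨ cong (count F 0) (m∸n+n≡m o≤n) ⟩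
  count F 0 n                                 ∎
  where
  open ≡-Reasoning
  G = F ∘ offset n o
  wrapped : ∀ i → i < o → G i ≡ F (n ∸ o + i)
  wrapped i i<o = cong F (trans (offset-< n i<o) (trans (+-∸-assoc i o≤n) (+-comm i (n ∸ o))))
  shifted : ∀ i → i < n ∸ o → G (o + i) ≡ F i
  shifted i _ = cong F (trans (offset-≥ n (m≤m+n o i)) (m+n∸m≡n o i))

-- The windows [0, k) and [g, g + k) of an n-cycle share k ∸ g positions without and g + k ∸ n with wrapping around.
meetSize : ℕ → ℕ → ℕ → ℕ
meetSize n k g = (g + k ∸ n) + (k ∸ g)

count-meet : ∀ n k g → k ≤ n → g < n → count (λ r → (r <ᵇ k) ∧ (offset n g r <ᵇ k)) 0 n ≡ meetSize n k g
count-meet n k g k≤n g<n = begin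
  count H 0 n                                 ≡⟨ cong (count H 0) (sym (m+[n∸m]≡n (<⇒≤ g<n))) ⟩
  count H 0 (g + (n ∸ g))                     ≡⟨ count-+ H 0 g (n ∸ g) ⟩
  count H 0 g + count H g (n ∸ g)
    ≡⟨ cong₂ _+_ (count-cong H (_<ᵇ c) 0 0 g wrapped) (count-cong H (_<ᵇ k) g g (n ∸ g) shifted) ⟩
  count (_<ᵇ c) 0 g + count (_<ᵇ k) g (n ∸ g) ≡⟨ cong₂ _+_ (count-<ᵇ c 0 g) (count-<ᵇ k g (n ∸ g)) ⟩
  c ⊓ g + (k ∸ g) ⊓ (n ∸ g)
    ≡⟨ cong₂ _+_ (m≤n⇒m⊓n≡m c≤g) (m≤n⇒m⊓n≡m (∸-monoˡ-≤ g k≤n)) ⟩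
  meetSize n k g                              ∎
  where
  open ≡-Reasoning
  H = λ r → (r <ᵇ k) ∧ (offset n g r <ᵇ k)
  c = g + k ∸ n
  c≤g : c ≤ g
  c≤g = m≤n+o⇒m∸n≤o (g + k) n (subst (g + k ≤_) (+-comm g n) (+-monoʳ-≤ g k≤n))
  wrapped : ∀ r → r < g → H (0 + r) ≡ (0 + r <ᵇ c)
  wrapped r r<g rewrite offset-< n r<g | sym (<ᵇ-∸ k (≤-trans (<⇒≤ g<n) (m≤n+m n r))) with r + n <? g + k
  ... | yes r+n<g+k
    rewrite <ᵇ-true {r} {k} (+-cancelʳ-< n r k (<-≤-trans r+n<g+k (subst (g + k ≤_) (+-comm n k) (+-monoˡ-≤ k (<⇒≤ g<n)))))
                          | <ᵇ-true r+n<g+k | <ᵇ-true {r} {c} (m+n≤o⇒m≤o∸n (suc r) r+n<g+k) = refl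
  ... | no r+n≮g+k rewrite <ᵇ-false {r + n} {g + k} (≮⇒≥ r+n≮g+k)
                         | <ᵇ-false {r} {c} (m≤n+o⇒m∸n≤o (g + k) n (subst (g + k ≤_) (+-comm r n) (≮⇒≥ r+n≮g+k)))
    = ∧-zeroʳ (r <ᵇ k)
  shifted : ∀ i → i < n ∸ g → H (g + i) ≡ (g + i <ᵇ k)
  shifted i _ rewrite offset-≥ n (m≤m+n g i) | m+n∸m≡n g i with g + i <? k
  ... | yes g+i<k rewrite <ᵇ-true g+i<k | <ᵇ-true {i} {k} (≤-<-trans (m≤n+m i g) g+i<k) = refl
  ... | no g+i≮k rewrite <ᵇ-false {g + i} {k} (≮⇒≥ g+i≮k) = refl

∈-tabulate⁻ : ∀ {n} (f : Fin n → Bool) {v} → v ∈ˢ tabulate f → f v ≡ true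
∈-tabulate⁻ f {v} v∈ = trans (sym (lookup∘tabulate f v)) ([]=⇒lookup v∈)

∈-tabulate⁺ : ∀ {n} (f : Fin n → Bool) {v} → f v ≡ true → v ∈ˢ tabulate f
∈-tabulate⁺ f {v} fv = lookup⇒[]= v (tabulate f) (trans (lookup∘tabulate f v) fv)

tabulate-∩ : ∀ {n} (f g : Fin n → Bool) → tabulate f ∩ tabulate g ≡ tabulate (λ i → f i ∧ g i)
tabulate-∩ {zero}  f g = refl
tabulate-∩ {suc n} f g = cong (f zero ∧ g zero ∷_) (tabulate-∩ (f ∘ suc) (g ∘ suc))

module _ {n} (π : Permutation′ n) (k : ℕ) where

  cyclicBlock-offset : ∀ s → k ≤ n → s ≤ n → cyclicBlock π k s ≡ tabulate (λ v → offset n s (position π v) <ᵇ k)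
  cyclicBlock-offset s k≤n s≤n = tabulate-cong (λ v → cyclicWindowᵇ-offset n k s (position π v) k≤n s≤n (toℕ<n _))

  linearBlock≡cyclicBlock : ∀ s → s + k ≤ n → linearBlock π k s ≡ cyclicBlock π k s
  linearBlock≡cyclicBlock s s+k≤n = tabulate-cong λ v →
    sym (trans (cong (((s ≤ᵇ position π v) ∧ (position π v <ᵇ s + k)) ∨_)
                     (<ᵇ-false (≤-trans s+k≤n (m≤n+m n (position π v)))))
               (∨-identityʳ _))

  ∣cyclicBlock∩cyclicBlock∣ : ∀ s s' → k ≤ n → s ≤ s' → s' < n →
    ∣ cyclicBlock π k s ∩ cyclicBlock π k s' ∣ ≡ meetSize n k (s' ∸ s)
  ∣cyclicBlock∩cyclicBlock∣ s s' k≤n s≤s' s'<n = begin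
    ∣ cyclicBlock π k s ∩ cyclicBlock π k s' ∣   ≡⟨ cong ∣_∣ (tabulate-∩ (window s ∘ position π) (window s' ∘ position π)) ⟩
    ∣ tabulate (both ∘ position π) ∣             ≡⟨ ∣tabulate∘position∣ π both ⟩
    count both 0 n                              ≡⟨ count-cong both (H ∘ offset n s) 0 0 n (λ x → relative x) ⟩
    count (H ∘ offset n s) 0 n                  ≡⟨ count-offset n s H s≤n ⟩
    count H 0 n                                 ≡⟨ count-meet n k g k≤n g<n ⟩
    meetSize n k g                              ∎
    where
    open ≡-Reasoning
    window = cyclicWindowᵇ n k
    both = λ x → window s x ∧ window s' x
    g = s' ∸ s
    s≤n = ≤-trans s≤s' (<⇒≤ s'<n)
    g<n : g < n
    g<n = ≤-<-trans (m∸n≤m s' s) s'<n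
    H = λ r → (r <ᵇ k) ∧ (offset n g r <ᵇ k)
    relative : ∀ x → x < n → both x ≡ H (offset n s x)
    relative x x<n = cong₂ _∧_ (cyclicWindowᵇ-offset n k s x k≤n s≤n x<n)
      (trans (cyclicWindowᵇ-offset n k s' x k≤n (<⇒≤ s'<n) x<n)
        (cong (_<ᵇ k) (trans (sym (offset-relative n s s' x s≤n s'<n x<n))
          (cong (λ z → offset n z (offset n s x)) (offset-≥ n s≤s')))))

-- Runs of consecutive vertices

PartitionInsideEdges : ∀ {n} → ℕ → List (Subset n) → Set
PartitionInsideEdges {n} q E =
  Σ (List (Subset n)) λ P → IsPartitionInto q P × (∀ S → S ∈ P → Σ (Subset n) λ e → e ∈ E × S ⊆ e)

inChunkᵇ : ℕ → ℕ → ℕ → Bool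
inChunkᵇ q j r = (j * q ≤ᵇ r) ∧ (r <ᵇ j * q + q)

chunk : ∀ {n} → Permutation′ n → (o q j : ℕ) → Subset n
chunk {n} π o q j = tabulate (inChunkᵇ q j ∘ offset n o ∘ position π)

module _ {n} (π : Permutation′ n) (o q : ℕ) where

  ∈-chunk⁻ : ∀ j {v} → v ∈ˢ chunk π o q j →
    j * q ≤ offset n o (position π v) × offset n o (position π v) < j * q + q
  ∈-chunk⁻ j v∈ with ∧-true⁻¹ (∈-tabulate⁻ (inChunkᵇ q j ∘ offset n o ∘ position π) v∈)
  ... | lower , upper = ≤ᵇ-true⁻¹ lower , <ᵇ-true⁻¹ upper

  ∈-chunk⁺ : ∀ j {v} → j * q ≤ offset n o (position π v) → offset n o (position π v) < j * q + q →
    v ∈ˢ chunk π o q j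
  ∈-chunk⁺ j lower upper = ∈-tabulate⁺ _ (cong₂ _∧_ (≤ᵇ-true lower) (<ᵇ-true upper))

  chunk-index-unique : ∀ {i j r} → i * q ≤ r → r < i * q + q → j * q ≤ r → r < j * q + q → i ≡ j
  chunk-index-unique {i} {j} iq≤r r<iq+q jq≤r r<jq+q with <-cmp i j
  ... | tri≈ _ i≡j _ = i≡j
  ... | tri< i<j _ _ = contradiction (≤-trans (subst (_≤ j * q) (+-comm q (i * q)) (*-monoˡ-≤ q i<j)) jq≤r) (<⇒≱ r<iq+q)
  ... | tri> _ _ j<i = contradiction (≤-trans (subst (_≤ i * q) (+-comm q (j * q)) (*-monoˡ-≤ q j<i)) iq≤r) (<⇒≱ r<jq+q)

  chunks-disjoint : ∀ {i j} → i ≢ j → Disjoint (chunk π o q i) (chunk π o q j)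
  chunks-disjoint {i} {j} i≢j (v , v∈i∩j) with x∈p∩q⁻ _ _ v∈i∩j
  ... | v∈i , v∈j with ∈-chunk⁻ i v∈i | ∈-chunk⁻ j v∈j
  ... | iq≤r , r<iq+q | jq≤r , r<jq+q = i≢j (chunk-index-unique iq≤r r<iq+q jq≤r r<jq+q)

  ∣chunk∣ : ∀ j → o ≤ n → j * q ≤ n → ∣ chunk π o q j ∣ ≡ q ⊓ (n ∸ j * q)
  ∣chunk∣ j o≤n jq≤n = begin
    ∣ chunk π o q j ∣                                  ≡⟨ ∣tabulate∘position∣ π (inChunkᵇ q j ∘ offset n o) ⟩
    count (inChunkᵇ q j ∘ offset n o) 0 n              ≡⟨ count-offset n o (inChunkᵇ q j) o≤n ⟩
    count (inChunkᵇ q j) 0 n                           ≡⟨ cong (count (inChunkᵇ q j) 0) (sym (m+[n∸m]≡n jq≤n)) ⟩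
    count (inChunkᵇ q j) 0 (j * q + (n ∸ j * q))       ≡⟨ count-+ (inChunkᵇ q j) 0 (j * q) (n ∸ j * q) ⟩
    count (inChunkᵇ q j) 0 (j * q) + count (inChunkᵇ q j) (j * q) (n ∸ j * q)
      ≡⟨ cong₂ _+_ (count-cong _ (_<ᵇ 0) 0 0 (j * q) before)
                   (count-cong _ (_<ᵇ j * q + q) (j * q) (j * q) (n ∸ j * q) after) ⟩
    count (_<ᵇ 0) 0 (j * q) + count (_<ᵇ j * q + q) (j * q) (n ∸ j * q)
      ≡⟨ cong₂ _+_ (count-<ᵇ 0 0 (j * q)) (count-<ᵇ (j * q + q) (j * q) (n ∸ j * q)) ⟩
    (j * q + q ∸ j * q) ⊓ (n ∸ j * q)                  ≡⟨ cong (_⊓ (n ∸ j * q)) (m+n∸m≡n (j * q) q) ⟩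
    q ⊓ (n ∸ j * q)                                    ∎
    where
    open ≡-Reasoning
    before : ∀ r → r < j * q → inChunkᵇ q j r ≡ (r <ᵇ 0)
    before r r<jq rewrite ≤ᵇ-false r<jq = refl
    after : ∀ r → r < n ∸ j * q → inChunkᵇ q j (j * q + r) ≡ (j * q + r <ᵇ j * q + q)
    after r _ rewrite ≤ᵇ-true (m≤m+n (j * q) r) = refl

applyUpTo-+ : ∀ {A : Set} (f : ℕ → A) m l → applyUpTo f (m + l) ≡ applyUpTo f m ++ applyUpTo (f ∘ (m +_)) l
applyUpTo-+ f zero    l = refl
applyUpTo-+ f (suc m) l = cong (f 0 ∷_) (applyUpTo-+ (f ∘ suc) m l)

partialChunks : ℕ → ℕ
partialChunks zero    = 0
partialChunks (suc _) = 1

module _ {n} (π : Permutation′ n) (o q : ℕ) .{{_ : NonZero q}} (o≤n : o ≤ n) where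

  private
    c = n / q
    q>0 = >-nonZero⁻¹ q
    n≡cq+n%q : n ≡ c * q + n % q
    n≡cq+n%q = trans (m≡m%n+[m/n]*n n q) (+-comm (n % q) (c * q))
    cq≤n : c * q ≤ n
    cq≤n = m/n*n≤m n q

    index-bound : ∀ j r → n % q ≡ r → j < c + partialChunks r → j * q < n
    index-bound j zero    _ j<c+0 =
      <-≤-trans (m<n+m (j * q) q>0) (≤-trans (*-monoˡ-≤ q (subst (suc j ≤_) (+-identityʳ c) j<c+0)) cq≤n)
    index-bound j (suc r) n%q≡1+r j<c+1 =
      ≤-<-trans (*-monoˡ-≤ q (≤-pred (subst (suc j ≤_) (+-comm c 1) j<c+1)))
        (subst (c * q <_) (sym (trans n≡cq+n%q (cong (c * q +_) n%q≡1+r))) (m<m+n (c * q) z<s))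

    n≤chunkCount*q : ∀ r → n % q ≡ r → n ≤ (c + partialChunks r) * q
    n≤chunkCount*q zero    n%q≡0 = ≤-reflexive (trans n≡cq+n%q (trans (cong (c * q +_) n%q≡0)
                                      (trans (+-identityʳ (c * q)) (cong (_* q) (sym (+-identityʳ c))))))
    n≤chunkCount*q (suc r) _ = subst (n ≤_) (sym (*-distribʳ-+ q c 1))
      (subst (_≤ c * q + 1 * q) (sym n≡cq+n%q)
        (+-monoʳ-≤ (c * q) (subst (n % q ≤_) (sym (*-identityˡ q)) (<⇒≤ (m%n<n n q)))))

    full-chunk-size : ∀ {j} → j < c → ∣ chunk π o q j ∣ ≡ q
    full-chunk-size {j} j<c = trans (∣chunk∣ π o q j o≤n (<⇒≤ jq<n)) (m≤n⇒m⊓n≡m (m+n≤o⇒m≤o∸n q q+jq≤n))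
      where
      q+jq≤n : q + j * q ≤ n
      q+jq≤n = ≤-trans (*-monoˡ-≤ q j<c) cq≤n
      jq<n : j * q < n
      jq<n = <-≤-trans (m<n+m (j * q) q>0) q+jq≤n

    PartialChunk : Subset n → Set
    PartialChunk S = 0 < ∣ S ∣ × ∣ S ∣ < q

    partial-chunk : ∀ r → n % q ≡ r → All PartialChunk (applyUpTo (chunk π o q ∘ (c +_)) (partialChunks r))
    partial-chunk zero    _ = []
    partial-chunk (suc r) n%q≡1+r = (subst (0 <_) (sym size) z<s , subst (_< q) (sym size) 1+r<q) ∷ []
      where
      1+r<q : suc r < q
      1+r<q = subst (_< q) n%q≡1+r (m%n<n n q)
      size : ∣ chunk π o q (c + 0) ∣ ≡ suc r
      size = begin
        ∣ chunk π o q (c + 0) ∣ ≡⟨ cong (λ j → ∣ chunk π o q j ∣) (+-identityʳ c) ⟩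
        ∣ chunk π o q c ∣       ≡⟨ ∣chunk∣ π o q c o≤n cq≤n ⟩
        q ⊓ (n ∸ c * q)         ≡⟨ cong (q ⊓_) (trans (sym (m%n≡m∸m/n*n n q)) n%q≡1+r) ⟩
        q ⊓ suc r               ≡⟨ m≥n⇒m⊓n≡n (<⇒≤ 1+r<q) ⟩
        suc r                   ∎
        where open ≡-Reasoning

    offset-bounds : ∀ r → (r / q) * q ≤ r × r < (r / q) * q + q
    offset-bounds r = m/n*n≤m r q ,
      subst (_< (r / q) * q + q) (sym (trans (m≡m%n+[m/n]*n r q) (+-comm (r % q) ((r / q) * q))))
        (+-monoʳ-< ((r / q) * q) (m%n<n r q))

  chunks : List (Subset n)
  chunks = applyUpTo (chunk π o q) (c + partialChunks (n % q))

  chunks-isPartition : IsPartitionInto q chunks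
  chunks-isPartition =
    AllPairs.applyUpTo⁺₁ (chunk π o q) _ (λ i<j _ → chunks-disjoint π o q (<⇒≢ i<j)) ,
    cover ,
    applyUpTo (chunk π o q) c , applyUpTo (chunk π o q ∘ (c +_)) (partialChunks (n % q)) ,
    applyUpTo-+ (chunk π o q) c (partialChunks (n % q)) ,
    All.applyUpTo⁺₁ (chunk π o q) c full-chunk-size ,
    subst (_≤ 1) (sym (length-applyUpTo _ (partialChunks (n % q)))) (partialChunks≤1 (n % q)) ,
    partial-chunk (n % q) refl
    where
    partialChunks≤1 : ∀ r → partialChunks r ≤ 1
    partialChunks≤1 zero    = z≤n
    partialChunks≤1 (suc _) = ≤-refl
    cover : ∀ v → Σ (Subset n) λ S → S ∈ chunks × v ∈ˢ S
    cover v = chunk π o q (r / q) ,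
              ∈-applyUpTo⁺ (chunk π o q) (m<n*o⇒m/o<n (<-≤-trans r<n (n≤chunkCount*q (n % q) refl))) ,
              ∈-chunk⁺ π o q (r / q) (proj₁ (offset-bounds r)) (proj₂ (offset-bounds r))
      where
      r = offset n o (position π v)
      r<n = offset<n n o (position π v) o≤n (toℕ<n _)

  chunks⊆edges⇒partitionInsideEdges : (E : List (Subset n)) →
    (∀ j → j * q < n → Σ (Subset n) λ e → e ∈ E × chunk π o q j ⊆ e) → PartitionInsideEdges q E
  chunks⊆edges⇒partitionInsideEdges E chunk⊆edge = chunks , chunks-isPartition , inside
    where
    inside : ∀ S → S ∈ chunks → Σ (Subset n) λ e → e ∈ E × S ⊆ e
    inside S S∈ with ∈-applyUpTo⁻ (chunk π o q) S∈
    ... | j , j<count , refl = chunk⊆edge j (index-bound j (n % q) refl j<count)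

-- Chunk j lies in the window of k positions starting at t, all positions being counted from the chunk's origin.
ChunkInWindow : ℕ → ℕ → ℕ → ℕ → ℕ → Set
ChunkInWindow n k q j t = ∀ r → r < n → j * q ≤ r → r < j * q + q → offset n t r < k

chunk⊆cyclicBlock : ∀ {n} (π : Permutation′ n) {k} o q j {s} → k ≤ n → o ≤ n → s < n →
  ChunkInWindow n k q j (offset n o s) → chunk π o q j ⊆ cyclicBlock π k s
chunk⊆cyclicBlock {n} π {k} o q j {s} k≤n o≤n s<n inWindow {v} v∈chunk =
  subst (v ∈ˢ_) (sym (cyclicBlock-offset π k s k≤n (<⇒≤ s<n)))
    (∈-tabulate⁺ _ (<ᵇ-true (subst (_< k) (offset-relative n o s (position π v) o≤n s<n (toℕ<n _))
      (inWindow r (offset<n n o (position π v) o≤n (toℕ<n _)) (proj₁ bounds) (proj₂ bounds)))))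
  where
  r = offset n o (position π v)
  bounds = ∈-chunk⁻ π o q j v∈chunk

private
  m<n+o⇒m∸n<o′ : ∀ {t r k} → t ≤ r → r < t + k → r ∸ t < k
  m<n+o⇒m∸n<o′ {t} {r} {k} t≤r r<t+k =
    +-cancelʳ-< t (r ∸ t) k (subst (_< k + t) (sym (m∸n+n≡m t≤r)) (subst (r <_) (+-comm t k) r<t+k))

chunkInWindow : ∀ n k q j t → t ≤ j * q → (j * q + q ≤ t + k ⊎ n ≤ t + k) → ChunkInWindow n k q j t
chunkInWindow n k q j t t≤jq end r r<n jq≤r r<jq+q = subst (_< k) (sym (offset-≥ n t≤r)) (m<n+o⇒m∸n<o′ t≤r r<t+k)
  where
  t≤r = ≤-trans t≤jq jq≤r
  r<t+k : r < t + k
  r<t+k = [ <-≤-trans r<jq+q , <-≤-trans r<n ]′ end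

chunkInWrappedWindow : ∀ n k q j t → t < n → j * q + q ≤ t → j * q + q + n ≤ t + k → ChunkInWindow n k q j t
chunkInWrappedWindow n k q j t t<n jq+q≤t end r r<n _ r<jq+q = subst (_< k) (sym (offset-< n (<-≤-trans r<jq+q jq+q≤t)))
  (m<n+o⇒m∸n<o′ (≤-trans (<⇒≤ t<n) (m≤n+m n r)) (<-≤-trans (+-monoˡ-< n r<jq+q) end))

-- Consecutive edges

meetSize-0 : ∀ {n k} → k ≤ n → meetSize n k 0 ≡ k
meetSize-0 {k = k} k≤n = cong (_+ k) (m≤n⇒m∸n≡0 k≤n)

module _ {k ℓ d : ℕ} (k≡d+ℓ : k ≡ d + ℓ) (ℓ>0 : 0 < ℓ) where

  k∸g≡ℓ⇒g≡d : ∀ {g} → k ∸ g ≡ ℓ → g ≡ d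
  k∸g≡ℓ⇒g≡d {g} k∸g≡ℓ with g ≤? k
  ... | no  g≰k = contradiction (trans (sym k∸g≡ℓ) (m≤n⇒m∸n≡0 (<⇒≤ (≰⇒> g≰k)))) (>⇒≢ ℓ>0)
  ... | yes g≤k = +-cancelʳ-≡ ℓ g d (begin
    g + ℓ       ≡⟨ cong (g +_) (sym k∸g≡ℓ) ⟩
    g + (k ∸ g) ≡⟨ m+[n∸m]≡n g≤k ⟩
    k           ≡⟨ k≡d+ℓ ⟩
    d + ℓ       ∎)
    where open ≡-Reasoning

  meetSize-unwrapped : ∀ {n g} → g + k ≤ n → meetSize n k g ≡ ℓ → g ≡ d
  meetSize-unwrapped {n} {g} g+k≤n meet = k∸g≡ℓ⇒g≡d (trans (cong (_+ (k ∸ g)) (sym (m≤n⇒m∸n≡0 g+k≤n))) meet)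

  meetSize-overlapping : ∀ {n g} → n ≤ g + k → g ≤ k → meetSize n k g ≡ ℓ → n ≡ k + d
  meetSize-overlapping {n} {g} n≤g+k g≤k meet = +-cancelʳ-≡ (ℓ + g) n (k + d) (begin
    n + (ℓ + g)                         ≡⟨ cong (λ m → n + (m + g)) (sym meet) ⟩
    n + ((g + k ∸ n) + (k ∸ g) + g)     ≡⟨ rearrange n (g + k ∸ n) (k ∸ g) g ⟩
    (g + k ∸ n + n) + (k ∸ g + g)       ≡⟨ cong₂ _+_ (m∸n+n≡m n≤g+k) (m∸n+n≡m g≤k) ⟩
    g + k + k                           ≡⟨ cong (g + k +_) k≡d+ℓ ⟩
    g + k + (d + ℓ)                     ≡⟨ rearrange′ g k d ℓ ⟩
    k + d + (ℓ + g)                     ∎)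
    where
    open ≡-Reasoning
    rearrange : ∀ a b c e → a + (b + c + e) ≡ (b + a) + (c + e)
    rearrange = solve-∀
    rearrange′ : ∀ a b c e → a + b + (c + e) ≡ b + c + (e + a)
    rearrange′ = solve-∀

  meetSize-wrapped : ∀ {n g} → n ≤ g + k → k ≤ g → meetSize n k g ≡ ℓ → g + d ≡ n
  meetSize-wrapped {n} {g} n≤g+k k≤g meet = +-cancelʳ-≡ ℓ (g + d) n (begin
    g + d + ℓ     ≡⟨ +-assoc g d ℓ ⟩
    g + (d + ℓ)   ≡⟨ cong (g +_) (sym k≡d+ℓ) ⟩
    g + k         ≡⟨ sym (m∸n+n≡m n≤g+k) ⟩
    g + k ∸ n + n ≡⟨ cong (_+ n) wrap ⟩
    ℓ + n         ≡⟨ +-comm ℓ n ⟩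
    n + ℓ         ∎)
    where
    open ≡-Reasoning
    wrap : g + k ∸ n ≡ ℓ
    wrap = trans (sym (trans (cong (g + k ∸ n +_) (m≤n⇒m∸n≡0 k≤g)) (+-identityʳ _))) meet

  meetSize⇒gap : ∀ {n g} → n ≢ k + d → meetSize n k g ≡ ℓ → (g ≡ d ⊎ g + d ≡ n) × k + d < n
  meetSize⇒gap {n} {g} n≢k+d meet with g + k ≤? n
  ... | yes g+k≤n = inj₁ g≡d , ≤∧≢⇒< (subst (_≤ n) (trans (+-comm g k) (cong (k +_) g≡d)) g+k≤n) (n≢k+d ∘ sym)
    where g≡d = meetSize-unwrapped g+k≤n meet
  ... | no g+k≰n with g ≤? k
  ...   | yes g≤k = contradiction (meetSize-overlapping (<⇒≤ (≰⇒> g+k≰n)) g≤k meet) n≢k+d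
  ...   | no  g≰k = inj₂ g+d≡n , subst (k + d <_) g+d≡n (+-monoˡ-< d (≰⇒> g≰k))
    where g+d≡n = meetSize-wrapped (<⇒≤ (≰⇒> g+k≰n)) (<⇒≤ (≰⇒> g≰k)) meet

  meetSize⇒gap-tight : ∀ {n g} → n ≡ k + d → meetSize n k g ≡ ℓ → d ≤ g × g ≤ k
  meetSize⇒gap-tight {n} {g} n≡k+d meet with g + k ≤? n | g ≤? k
  ... | yes g+k≤n | _       = ≤-reflexive (sym g≡d) , subst (_≤ k) (sym g≡d) (subst (d ≤_) (sym k≡d+ℓ) (m≤m+n d ℓ))
    where g≡d = meetSize-unwrapped g+k≤n meet
  ... | no g+k≰n  | yes g≤k =
    <⇒≤ (+-cancelˡ-< k d g (subst (_< k + g) n≡k+d (subst (n <_) (+-comm g k) (≰⇒> g+k≰n)))) , g≤k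
  ... | no g+k≰n  | no g≰k  =
    contradiction (+-cancelʳ-≡ d g k (trans (meetSize-wrapped (<⇒≤ (≰⇒> g+k≰n)) (<⇒≤ (≰⇒> g≰k)) meet) n≡k+d))
                  (>⇒≢ (≰⇒> g≰k))

two-windows-miss : ∀ {n k d x y} → x < y → y < n → (y ∸ x ≡ d ⊎ y ∸ x + d ≡ n) → k + d < n →
  Σ ℕ λ p → p < n × k ≤ offset n x p × k ≤ offset n y p
two-windows-miss {n} {k} {d} {x} {y} x<y y<n gap k+d<n with missed gap
  where
  g = y ∸ x
  missed : (g ≡ d ⊎ g + d ≡ n) → Σ ℕ λ r → r < n × k ≤ r × k ≤ offset n g r
  missed (inj₁ g≡d) = d + k , subst (_< n) (+-comm k d) k+d<n , m≤n+m k d ,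
    ≤-reflexive (sym (trans (cong (λ g → offset n g (d + k)) g≡d) (trans (offset-≥ n (m≤m+n d k)) (m+n∸m≡n d k))))
  missed (inj₂ g+d≡n) = k , ≤-<-trans (m≤m+n k d) k+d<n , ≤-refl ,
    subst (k ≤_) (sym (trans (offset-< n k<g) (+-∸-assoc k g≤n))) (m≤m+n k (n ∸ g))
    where
    k<g : k < g
    k<g = +-cancelʳ-< d k g (subst (k + d <_) (sym g+d≡n) k+d<n)
    g≤n : g ≤ n
    g≤n = subst (g ≤_) g+d≡n (m≤m+n g d)
... | r , r<n , k≤r , k≤offset = p , p<n , subst (k ≤_) (sym xp≡r) k≤r ,
  subst (k ≤_) (trans (cong₂ (offset n) (sym (offset-≥ n (<⇒≤ x<y))) (sym xp≡r))
                      (offset-relative n x y p (<⇒≤ x<n) y<n p<n)) k≤offset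
  where
  x<n = <-trans x<y y<n
  surj = offset-surjective n x<n r<n
  p = proj₁ surj
  p<n = proj₁ (proj₂ surj)
  xp≡r = proj₂ (proj₂ surj)

Step : ℕ → ℕ → ℕ → Set
Step d a b = b ≡ a + d

CyclicStep : ℕ → ℕ → ℕ → ℕ → Set
CyclicStep n d a b = b ≡ a + d ⊎ b + d ≡ a + n

module _ {d : ℕ} where

  progression-∈⁻ : ∀ {x xs y} → Linked (Step d) (x ∷ xs) → y ∈ x ∷ xs →
    Σ ℕ λ i → i < suc (length xs) × y ≡ x + i * d
  progression-∈⁻ {x} _ (here refl) = 0 , z<s , sym (+-identityʳ x)
  progression-∈⁻ {x} (x′≡x+d ∷ steps) (there y∈) with progression-∈⁻ steps y∈
  ... | i , i<len , y≡x′+id = suc i , s≤s i<len , trans y≡x′+id (trans (cong (_+ i * d) x′≡x+d) (+-assoc x d (i * d)))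

  progression-∈⁺ : ∀ {x xs i} → Linked (Step d) (x ∷ xs) → i < suc (length xs) → x + i * d ∈ x ∷ xs
  progression-∈⁺ {x} {i = zero} _ _ = here (+-identityʳ x)
  progression-∈⁺ {x} {x′ ∷ xs} {suc i} (x′≡x+d ∷ steps) (s≤s i<len) =
    there (subst (_∈ x′ ∷ xs) (trans (cong (_+ i * d) x′≡x+d) (+-assoc x d (i * d))) (progression-∈⁺ steps i<len))

  private
    cyclicSteps⇒steps-from : ∀ {n a r} → d ≤ a → Linked (CyclicStep n d) (a ∷ r) → All (_< n) (a ∷ r) →
      Linked (Step d) (a ∷ r)
    cyclicSteps⇒steps-from _ [-] _ = [-]
    cyclicSteps⇒steps-from {a = a} d≤a (inj₁ b≡a+d ∷ steps) (_ ∷ all) =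
      b≡a+d ∷ cyclicSteps⇒steps-from (subst (d ≤_) (sym b≡a+d) (m≤n+m d a)) steps all
    cyclicSteps⇒steps-from {n} {a} d≤a (inj₂ b+d≡a+n ∷ _) (_ ∷ b<n ∷ _) =
      contradiction (+-cancelʳ-≤ d n _ (subst (n + d ≤_) (sym b+d≡a+n) (subst (_≤ a + n) (+-comm d n) (+-monoˡ-≤ n d≤a))))
                    (<⇒≱ b<n)

  -- Going once backwards round the cycle from the first start overshoots the third start.
  cyclicSteps⇒steps : ∀ {n x y z r} → d + d ≤ n → Linked (CyclicStep n d) (x ∷ y ∷ z ∷ r) →
    All (_< n) (x ∷ y ∷ z ∷ r) → Linked (Step d) (x ∷ y ∷ z ∷ r)
  cyclicSteps⇒steps {x = x} _ (inj₁ y≡x+d ∷ steps) (_ ∷ all) =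
    y≡x+d ∷ cyclicSteps⇒steps-from (subst (d ≤_) (sym y≡x+d) (m≤n+m d x)) steps all
  cyclicSteps⇒steps {n} {x} {y} 2d≤n (inj₂ y+d≡x+n ∷ steps) (_ ∷ all@(_ ∷ z<n ∷ _))
    with cyclicSteps⇒steps-from d≤y steps all
    where
    d≤y : d ≤ y
    d≤y = +-cancelʳ-≤ d d y (subst (d + d ≤_) (sym y+d≡x+n) (≤-trans 2d≤n (m≤n+m n x)))
  ... | z≡y+d ∷ _ = contradiction (subst (n ≤_) (sym (trans z≡y+d y+d≡x+n)) (m≤n+m n x)) (<⇒≱ z<n)

module _ {A : Set} {P : A → Set} {Q R S : A → A → Set} where

  linked-combine : (∀ {a b} → Q a b → P b → R a b → S a b) →
    ∀ {xs} → Linked Q xs → All P xs → Linked R xs → Linked S xs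
  linked-combine f []           _            []           = []
  linked-combine f [-]          _            [-]          = [-]
  linked-combine f (qab ∷ qs)   (_ ∷ all@(pb ∷ _)) (rab ∷ rs) = f qab pb rab ∷ linked-combine f qs all rs

lastOf-∈ : ∀ {A : Set} (x : A) xs → lastOf x xs ∈ x ∷ xs
lastOf-∈ x []       = here refl
lastOf-∈ x (y ∷ ys) = there (lastOf-∈ y ys)

lastOf-maximal : ∀ {x xs w} → Linked _<_ (x ∷ xs) → w ∈ x ∷ xs → w ≤ lastOf x xs
lastOf-maximal {xs = []}     _         (here refl) = ≤-refl
lastOf-maximal {xs = y ∷ ys} (x<y ∷ l) (here refl) = ≤-trans (<⇒≤ x<y) (lastOf-maximal l (here refl))
lastOf-maximal {xs = y ∷ ys} (_ ∷ l)   (there w∈)  = lastOf-maximal l w∈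

lastOf-map : ∀ {A B : Set} (f : A → B) x xs → lastOf (f x) (map f xs) ≡ f (lastOf x xs)
lastOf-map f x []       = refl
lastOf-map f x (y ∷ ys) = lastOf-map f y ys

-- Paths and cycles

module _ {k ℓ d : ℕ} (t : ℕ) .{{d≢0 : NonZero d}} .{{t≢0 : NonZero t}}
         (k≡d+ℓ : k ≡ d + ℓ) (ℓ>0 : 0 < ℓ) (td≤k : t * d ≤ k) where

  private
    q = t * d
    instance
      q≢0 : NonZero q
      q≢0 = m*n≢0 t d
    jq≡[jt]d : ∀ j → j * q ≡ (j * t) * d
    jq≡[jt]d j = sym (*-assoc j t d)
    d≤q : d ≤ q
    d≤q = m≤n*m d t
    d≤k : d ≤ k
    d≤k = subst (d ≤_) (sym k≡d+ℓ) (m≤m+n d ℓ)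
    k>0 : 0 < k
    k>0 = subst (0 <_) (sym k≡d+ℓ) (<-≤-trans ℓ>0 (m≤n+m ℓ d))

  module _ {n} (π : Permutation′ n) (E : List (Subset n)) where

    private
      lb = linearBlock π k

    linearBlock-meet⇒step : ∀ {a b} → a < b → b + k ≤ n → ∣ lb a ∩ lb b ∣ ≡ ℓ → Step d a b
    linearBlock-meet⇒step {a} {b} a<b b+k≤n meet = trans (sym (m+[n∸m]≡n (<⇒≤ a<b))) (cong (a +_) gap≡d)
      where
      a+k≤n = ≤-trans (+-monoˡ-≤ k (<⇒≤ a<b)) b+k≤n
      gap≡d : b ∸ a ≡ d
      gap≡d = meetSize-unwrapped k≡d+ℓ ℓ>0 (≤-trans (+-monoˡ-≤ k (m∸n≤m b a)) b+k≤n) (begin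
        meetSize n k (b ∸ a)                        ≡⟨ ∣cyclicBlock∩cyclicBlock∣ π k a b k≤n (<⇒≤ a<b) b<n ⟨
        ∣ cyclicBlock π k a ∩ cyclicBlock π k b ∣    ≡⟨ cong₂ (λ A B → ∣ A ∩ B ∣) (linearBlock≡cyclicBlock π k a a+k≤n)
                                                                                (linearBlock≡cyclicBlock π k b b+k≤n) ⟨
        ∣ lb a ∩ lb b ∣                              ≡⟨ meet ⟩
        ℓ                                           ∎)
        where
        open ≡-Reasoning
        k≤n = ≤-trans (m≤n+m k b) b+k≤n
        b<n = <-≤-trans (m<m+n b k>0) b+k≤n

    chunk⊆linearBlock : ∀ {j s} → s + k ≤ n → ChunkInWindow n k q j s → chunk π 0 q j ⊆ lb s
    chunk⊆linearBlock {j} {s} s+k≤n inWindow =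
      subst (chunk π 0 q j ⊆_) (sym (linearBlock≡cyclicBlock π k s s+k≤n))
        (chunk⊆cyclicBlock π 0 q j (≤-trans (m≤n+m k s) s+k≤n) z≤n (<-≤-trans (m<m+n s k>0) s+k≤n)
          (subst (ChunkInWindow n k q j) (sym (offset-≥ n {0} {s} z≤n)) inWindow))

    path-partition : ∀ x xs → Linked _<_ (x ∷ xs) → All (λ s → s + k ≤ n) (x ∷ xs) →
      ConsecutiveMeet ℓ (map lb (x ∷ xs)) → SameEdges E (map lb (x ∷ xs)) → NoIsolated E → 0 < n →
      PartitionInsideEdges q E
    path-partition x xs increasing fits meets sameEdges noIsolated n>0 =
      chunks⊆edges⇒partitionInsideEdges π 0 q z≤n E chunk⊆edge
      where
      starts = x ∷ xs
      steps : Linked (Step d) starts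
      steps = linked-combine linearBlock-meet⇒step increasing fits (Linked.map⁻ meets)

      covered : ∀ p → p < n → Σ ℕ λ s → s ∈ starts × s ≤ p × p < s + k
      covered p p<n with noIsolated (vertexAt π p p<n)
      ... | e , e∈E , v∈e with ∈-map⁻ lb (proj₁ sameEdges e e∈E)
      ... | s , s∈ , refl with ∧-true⁻¹ (∈-tabulate⁻ _ v∈e)
      ... | s≤p , p<s+k = s , s∈ ,
        subst (s ≤_) (position-vertexAt π p p<n) (≤ᵇ-true⁻¹ s≤p) ,
        subst (_< s + k) (position-vertexAt π p p<n) (<ᵇ-true⁻¹ p<s+k)

      x≡0 : x ≡ 0
      x≡0 with covered 0 n>0
      ... | s , s∈ , s≤0 , _ with progression-∈⁻ steps s∈
      ... | i , _ , s≡x+id = n≤0⇒n≡0 (≤-trans (m≤m+n x (i * d)) (subst (_≤ 0) s≡x+id s≤0))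

      n∸1<n : n ∸ 1 < n
      n∸1<n = ∸-monoʳ-< z<s n>0

      last = covered (n ∸ 1) n∸1<n
      sₗ = proj₁ last
      sₗ∈ = proj₁ (proj₂ last)
      n≤sₗ+k : n ≤ sₗ + k
      n≤sₗ+k = subst (_≤ sₗ + k) (m+[n∸m]≡n n>0) (proj₂ (proj₂ (proj₂ last)))

      edge : ∀ {s} j → s ∈ starts → ChunkInWindow n k q j s → Σ (Subset n) λ e → e ∈ E × chunk π 0 q j ⊆ e
      edge {s} j s∈ inWindow =
        lb s , proj₂ sameEdges (lb s) (∈-map⁺ lb s∈) , chunk⊆linearBlock {j} (All.lookup fits s∈) inWindow

      chunk⊆edge : ∀ j → j * q < n → Σ (Subset n) λ e → e ∈ E × chunk π 0 q j ⊆ e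
      chunk⊆edge j _ with j * q ≤? sₗ
      ... | no  jq≰sₗ = edge j sₗ∈ (chunkInWindow n k q j sₗ (<⇒≤ (≰⇒> jq≰sₗ)) (inj₂ n≤sₗ+k))
      ... | yes jq≤sₗ with progression-∈⁻ steps sₗ∈
      ... | i , i<len , sₗ≡x+id = edge j jq∈ (chunkInWindow n k q j (j * q) ≤-refl (inj₁ (+-monoʳ-≤ (j * q) td≤k)))
        where
        jt≤i : j * t ≤ i
        jt≤i = *-cancelʳ-≤ (j * t) i d (subst₂ _≤_ (jq≡[jt]d j) (trans sₗ≡x+id (cong (_+ i * d) x≡0)) jq≤sₗ)
        jq∈ : j * q ∈ starts
        jq∈ = subst (_∈ starts) (trans (cong (_+ (j * t) * d) x≡0) (sym (jq≡[jt]d j)))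
                (progression-∈⁺ steps (≤-<-trans jt≤i i<len))

  module _ {n} (π : Permutation′ n) (E : List (Subset n)) (k≤n : k ≤ n) where

    private
      cb = cyclicBlock π k

    cyclicBlock-meet : ∀ {a b} → a ≤ b → b < n → ∣ cb a ∩ cb b ∣ ≡ ℓ → meetSize n k (b ∸ a) ≡ ℓ
    cyclicBlock-meet {a} {b} a≤b b<n meet = trans (sym (∣cyclicBlock∩cyclicBlock∣ π k a b k≤n a≤b b<n)) meet

    cyclicBlock-meet⇒cyclicStep : n ≢ k + d → ∀ {a b} → a < b → b < n → ∣ cb a ∩ cb b ∣ ≡ ℓ → CyclicStep n d a b
    cyclicBlock-meet⇒cyclicStep n≢k+d {a} {b} a<b b<n meet
      with proj₁ (meetSize⇒gap k≡d+ℓ ℓ>0 n≢k+d (cyclicBlock-meet (<⇒≤ a<b) b<n meet))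
    ... | inj₁ gap≡d   = inj₁ (trans (sym (m+[n∸m]≡n (<⇒≤ a<b))) (cong (a +_) gap≡d))
    ... | inj₂ gap+d≡n = inj₂ (trans (cong (_+ d) (sym (m+[n∸m]≡n (<⇒≤ a<b))))
                                (trans (+-assoc a (b ∸ a) d) (cong (a +_) gap+d≡n)))

    module Starts (starts : List ℕ) (below : All (_< n) starts)
             (sameEdges : SameEdges E (map cb starts)) (noIsolated : NoIsolated E) where

      covered : ∀ p → p < n → Σ ℕ λ s → s ∈ starts × offset n s p < k
      covered p p<n with noIsolated (vertexAt π p p<n)
      ... | e , e∈E , v∈e with ∈-map⁻ cb (proj₁ sameEdges e e∈E)
      ... | s , s∈ , refl = s , s∈ , subst (λ r → offset n s r < k) (position-vertexAt π p p<n)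
        (<ᵇ-true⁻¹ (∈-tabulate⁻ _ (subst (vertexAt π p p<n ∈ˢ_)
          (cyclicBlock-offset π k s k≤n (<⇒≤ (All.lookup below s∈))) v∈e)))

      edge : ∀ o j {s} → o ≤ n → s ∈ starts → ChunkInWindow n k q j (offset n o s) →
        Σ (Subset n) λ e → e ∈ E × chunk π o q j ⊆ e
      edge o j {s} o≤n s∈ inWindow =
        cb s , proj₂ sameEdges (cb s) (∈-map⁺ cb s∈) , chunk⊆cyclicBlock π o q j k≤n o≤n (All.lookup below s∈) inWindow

      private
        ∈⇒<n : ∀ {s} → s ∈ starts → s < n
        ∈⇒<n = All.lookup below

      -- The chunks start with the first edge or, if the second starts more than q later, q before the second:
      -- then the first chunk lies in the first edge and, as n = k + d, all others lie in the second.
      tight-partition : n ≡ k + d → ∀ {x y} → x ∈ starts → y ∈ starts → x < y → d ≤ y ∸ x → y ∸ x ≤ k →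
        PartitionInsideEdges q E
      tight-partition n≡k+d {x} {y} x∈ y∈ x<y d≤g g≤k with y ∸ x ≤? q
      ... | yes g≤q = chunks⊆edges⇒partitionInsideEdges π x q (<⇒≤ (∈⇒<n x∈)) E chunk⊆edge
        where
        g = y ∸ x
        chunk⊆edge : ∀ j → j * q < n → Σ (Subset n) λ e → e ∈ E × chunk π x q j ⊆ e
        chunk⊆edge zero    _ = edge x 0 (<⇒≤ (∈⇒<n x∈)) x∈
          (subst (ChunkInWindow n k q 0) (sym (trans (offset-≥ n {x} ≤-refl) (n∸n≡0 x)))
            (chunkInWindow n k q 0 0 z≤n (inj₁ td≤k)))
        chunk⊆edge (suc j) _ = edge x (suc j) (<⇒≤ (∈⇒<n x∈)) y∈
          (subst (ChunkInWindow n k q (suc j)) (sym (offset-≥ n (<⇒≤ x<y)))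
            (chunkInWindow n k q (suc j) g (≤-trans g≤q (m≤m+n q (j * q)))
              (inj₂ (subst (_≤ g + k) (sym n≡k+d) (subst (k + d ≤_) (+-comm k g) (+-monoʳ-≤ k d≤g))))))
      ... | no g≰q = chunks⊆edges⇒partitionInsideEdges π o q (<⇒≤ o<n) E chunk⊆edge
        where
        open ≡-Reasoning
        g = y ∸ x
        y<n = ∈⇒<n y∈
        q<g = ≰⇒> g≰q
        y≡x+g : y ≡ x + g
        y≡x+g = sym (m+[n∸m]≡n (<⇒≤ x<y))
        q≤y : q ≤ y
        q≤y = ≤-trans (<⇒≤ q<g) (m∸n≤m y x)
        o = y ∸ q
        o<n = ≤-<-trans (m∸n≤m y q) y<n
        o+q≡y : o + q ≡ y
        o+q≡y = m∸n+n≡m q≤y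
        x<o : x < o
        x<o = +-cancelʳ-< q x o (subst (x + q <_) (trans (sym y≡x+g) (sym o+q≡y)) (+-monoʳ-< x q<g))
        t₀ = offset n o x
        t₀+o≡x+n : t₀ + o ≡ x + n
        t₀+o≡x+n = trans (cong (_+ o) (offset-< n x<o)) (m∸n+n≡m (≤-trans (<⇒≤ o<n) (m≤n+m n x)))
        t₀+g≡n+q : t₀ + g ≡ n + q
        t₀+g≡n+q = +-cancelʳ-≡ x (t₀ + g) (n + q) (begin
          t₀ + g + x     ≡⟨ +-assoc t₀ g x ⟩
          t₀ + (g + x)   ≡⟨ cong (t₀ +_) (trans (+-comm g x) (trans (sym y≡x+g) (sym o+q≡y))) ⟩
          t₀ + (o + q)   ≡⟨ +-assoc t₀ o q ⟨
          t₀ + o + q     ≡⟨ cong (_+ q) t₀+o≡x+n ⟩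
          x + n + q      ≡⟨ trans (+-assoc x n q) (+-comm x (n + q)) ⟩
          n + q + x      ∎)
        q≤t₀ : q ≤ t₀
        q≤t₀ = <⇒≤ (+-cancelʳ-< g q t₀ (subst (q + g <_) (sym t₀+g≡n+q)
                 (subst (q + g <_) (+-comm q n) (+-monoʳ-< q (≤-<-trans (m∸n≤m y x) y<n)))))
        chunk⊆edge : ∀ j → j * q < n → Σ (Subset n) λ e → e ∈ E × chunk π o q j ⊆ e
        chunk⊆edge zero    _ = edge o 0 (<⇒≤ o<n) x∈
          (chunkInWrappedWindow n k q 0 t₀ (offset<n n o x (<⇒≤ o<n) (∈⇒<n x∈)) q≤t₀
            (subst (_≤ t₀ + k) (trans t₀+g≡n+q (+-comm n q)) (+-monoʳ-≤ t₀ g≤k)))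
        chunk⊆edge (suc j) _ = edge o (suc j) (<⇒≤ o<n) y∈
          (subst (ChunkInWindow n k q (suc j)) (sym (trans (offset-≥ n (m∸n≤m y q)) (m∸[m∸n]≡n q≤y)))
            (chunkInWindow n k q (suc j) q (m≤m+n q (j * q))
              (inj₂ (subst (_≤ q + k) (sym n≡k+d) (subst (k + d ≤_) (+-comm k q) (+-monoʳ-≤ k d≤q))))))

    progression-partition : n ≢ k + d → ∀ x y z zs → Linked _<_ (x ∷ y ∷ z ∷ zs) → All (_< n) (x ∷ y ∷ z ∷ zs) →
      ConsecutiveMeet ℓ (map cb (x ∷ y ∷ z ∷ zs)) → WrapMeet ℓ (map cb (x ∷ y ∷ z ∷ zs)) →
      SameEdges E (map cb (x ∷ y ∷ z ∷ zs)) → NoIsolated E → PartitionInsideEdges q E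
    progression-partition n≢k+d x y z zs increasing@(x<y ∷ _) below@(_ ∷ y<n ∷ _) meets@(meet ∷ _)
                          wrap sameEdges noIsolated =
      chunks⊆edges⇒partitionInsideEdges π x q (<⇒≤ x<n) E chunk⊆edge
      where
      open Starts (x ∷ y ∷ z ∷ zs) below sameEdges noIsolated
      x<n = All.lookup below (here refl)
      k+d<n : k + d < n
      k+d<n = proj₂ (meetSize⇒gap k≡d+ℓ ℓ>0 n≢k+d (cyclicBlock-meet (<⇒≤ x<y) y<n meet))
      steps : Linked (Step d) (x ∷ y ∷ z ∷ zs)
      steps = cyclicSteps⇒steps (≤-trans (+-monoˡ-≤ d d≤k) (<⇒≤ k+d<n))
        (linked-combine (cyclicBlock-meet⇒cyclicStep n≢k+d) increasing below (Linked.map⁻ meets)) below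
      L = lastOf x (y ∷ z ∷ zs)
      L∈ = lastOf-∈ x (y ∷ z ∷ zs)
      x+d<L : x + d < L
      x+d<L = <-≤-trans (subst (x + d <_) (sym (z≡x+d+d steps)) (m<m+n (x + d) (>-nonZero⁻¹ d)))
                        (lastOf-maximal increasing (there (there (here refl))))
        where
        z≡x+d+d : Linked (Step d) (x ∷ y ∷ z ∷ zs) → z ≡ x + d + d
        z≡x+d+d (y≡x+d ∷ z≡y+d ∷ _) = trans z≡y+d (cong (_+ d) y≡x+d)
      L+d≡x+n : L + d ≡ x + n
      L+d≡x+n with cyclicBlock-meet⇒cyclicStep n≢k+d (≤-<-trans (m≤m+n x d) x+d<L) (All.lookup below L∈) wrap′
        where
        wrap′ : ∣ cb x ∩ cb L ∣ ≡ ℓ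
        wrap′ = trans (cong ∣_∣ (∩-comm (cb x) (cb L)))
                      (subst (λ e → ∣ e ∩ cb x ∣ ≡ ℓ) (lastOf-map cb x (y ∷ z ∷ zs)) wrap)
      ... | inj₁ L≡x+d   = contradiction L≡x+d (>⇒≢ x+d<L)
      ... | inj₂ L+d≡x+n = L+d≡x+n
      i = proj₁ (progression-∈⁻ steps L∈)
      i<len = proj₁ (proj₂ (progression-∈⁻ steps L∈))
      L≡x+id = proj₂ (proj₂ (progression-∈⁻ steps L∈))
      n≡[1+i]d : n ≡ suc i * d
      n≡[1+i]d = +-cancelˡ-≡ x n (suc i * d) (begin
        x + n             ≡⟨ L+d≡x+n ⟨
        L + d             ≡⟨ cong (_+ d) L≡x+id ⟩
        x + i * d + d     ≡⟨ +-assoc x (i * d) d ⟩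
        x + (i * d + d)   ≡⟨ cong (x +_) (+-comm (i * d) d) ⟩
        x + suc i * d     ∎)
        where open ≡-Reasoning
      chunk⊆edge : ∀ j → j * q < n → Σ (Subset n) λ e → e ∈ E × chunk π x q j ⊆ e
      chunk⊆edge j jq<n = edge x j (<⇒≤ x<n) (progression-∈⁺ steps (<-≤-trans jt<1+i i<len))
        (subst (ChunkInWindow n k q j)
               (sym (trans (offset-≥ n (m≤m+n x ((j * t) * d))) (trans (m+n∸m≡n x _) (sym (jq≡[jt]d j)))))
          (chunkInWindow n k q j (j * q) ≤-refl (inj₁ (+-monoʳ-≤ (j * q) td≤k))))
        where
        jt<1+i : j * t < suc i
        jt<1+i = *-cancelʳ-< d (j * t) (suc i) (subst₂ _<_ (jq≡[jt]d j) n≡[1+i]d jq<n)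

    two-edges-cannot-cover : n ≢ k + d → ∀ {x y} → x < y → All (_< n) (x ∷ y ∷ []) →
      ∣ cb x ∩ cb y ∣ ≡ ℓ → SameEdges E (map cb (x ∷ y ∷ [])) → NoIsolated E → ⊥
    two-edges-cannot-cover n≢k+d {x} {y} x<y below@(_ ∷ y<n ∷ _) meet sameEdges noIsolated
      with gap , k+d<n ← meetSize⇒gap k≡d+ℓ ℓ>0 n≢k+d (cyclicBlock-meet (<⇒≤ x<y) y<n meet)
      with p , p<n , k≤xp , k≤yp ← two-windows-miss x<y y<n gap k+d<n
      with Starts.covered (x ∷ y ∷ []) below sameEdges noIsolated p p<n
    ... | _ , here refl , sp<k         = <⇒≱ sp<k k≤xp
    ... | _ , there (here refl) , sp<k = <⇒≱ sp<k k≤yp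

    cycle-partition : ∀ starts → Linked _<_ starts → All (_< n) starts → ConsecutiveMeet ℓ (map cb starts) →
      WrapMeet ℓ (map cb starts) → SameEdges E (map cb starts) → NoIsolated E → PartitionInsideEdges q E
    cycle-partition [] _ _ _ _ sameEdges noIsolated
      with e , e∈E , _ ← noIsolated (vertexAt π 0 (<-≤-trans k>0 k≤n))
      with () ← proj₁ sameEdges e e∈E
    cycle-partition (x ∷ []) _ below _ wrap _ _ =
      contradiction (+-cancelʳ-≡ ℓ d 0 (trans (sym k≡d+ℓ) k≡ℓ)) (≢-nonZero⁻¹ d)
      where
      k≡ℓ : k ≡ ℓ
      k≡ℓ = trans (sym (meetSize-0 k≤n)) (trans (cong (meetSize n k) (sym (n∸n≡0 x)))
              (cyclicBlock-meet ≤-refl (All.lookup below (here refl)) wrap))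
    cycle-partition (x ∷ y ∷ ys) increasing@(x<y ∷ _) below@(_ ∷ y<n ∷ _) meets@(meet ∷ _)
                    wrap sameEdges noIsolated with n ≟ k + d
    ... | yes n≡k+d = Starts.tight-partition (x ∷ y ∷ ys) below sameEdges noIsolated n≡k+d
      (here refl) (there (here refl)) x<y (proj₁ gap-bounds) (proj₂ gap-bounds)
      where gap-bounds = meetSize⇒gap-tight k≡d+ℓ ℓ>0 n≡k+d (cyclicBlock-meet (<⇒≤ x<y) y<n meet)
    cycle-partition (x ∷ y ∷ []) (x<y ∷ _) below (meet ∷ _) _ sameEdges noIsolated | no n≢k+d =
      ⊥-elim (two-edges-cannot-cover n≢k+d x<y below meet sameEdges noIsolated)
    cycle-partition (x ∷ y ∷ z ∷ zs) increasing below meets wrap sameEdges noIsolated | no n≢k+d =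
      progression-partition n≢k+d x y z zs increasing below meets wrap sameEdges noIsolated

  partitionInsideEdges : ∀ {n} (E : List (Subset n)) → IsLCycle k ℓ n E ⊎ IsLPath k ℓ n E → PartitionInsideEdges q E
  partitionInsideEdges E (inj₁ (π , starts , k≤n , increasing , below , meets , wrap , sameEdges , noIsolated)) =
    cycle-partition π E k≤n starts increasing below meets wrap sameEdges noIsolated
  partitionInsideEdges {zero} E (inj₂ (π , _)) = chunks⊆edges⇒partitionInsideEdges π 0 q z≤n E (λ _ ())
  partitionInsideEdges {suc n} E (inj₂ (π , [] , _ , _ , _ , sameEdges , noIsolated))
    with e , e∈E , _ ← noIsolated (vertexAt π 0 z<s)
    with () ← proj₁ sameEdges e e∈E
  partitionInsideEdges {suc n} E (inj₂ (π , x ∷ xs , increasing , fits , meets , sameEdges , noIsolated)) =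
    path-partition π E x xs increasing fits meets sameEdges noIsolated z<s

partitionInsideEdges-blockSize : ∀ {k ℓ n} → ℓ < k → 0 < ℓ → (E : List (Subset n)) →
  IsLCycle k ℓ n E ⊎ IsLPath k ℓ n E → PartitionInsideEdges (blockSize k ℓ) E
partitionInsideEdges-blockSize {k} {ℓ} ℓ<k ℓ>0 E C with k ∸ ℓ in k∸ℓ≡d
... | zero  = contradiction k∸ℓ≡d (m>n⇒m∸n≢0 ℓ<k)
... | suc d = partitionInsideEdges (k / suc d) {{t≢0 = >-nonZero (m≥n⇒m/n>0 d≤k)}} k≡d+ℓ ℓ>0 (m/n*n≤m k (suc d)) E C
  where
  d≤k : suc d ≤ k
  d≤k = subst (_≤ k) k∸ℓ≡d (m∸n≤m k ℓ)
  k≡d+ℓ : k ≡ suc d + ℓ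
  k≡d+ℓ = trans (sym (m∸n+n≡m (<⇒≤ ℓ<k))) (cong (_+ ℓ) k∸ℓ≡d)

proposition1p4 : (k ℓ n : ℕ) → 3 ≤ k → 1 ≤ ℓ → ℓ ≤ k ∸ 1 →
    (E : List (Subset n)) → IsLCycle k ℓ n E ⊎ IsLPath k ℓ n E →
    Σ (List (Subset n)) λ P → IsPartitionInto (blockSize k ℓ) P ×
    (∀ S → S ∈ P → Σ (Subset n) λ e → e ∈ E × S ⊆ e)
proposition1p4 k ℓ n 3≤k ℓ>0 ℓ≤k∸1 =
  partitionInsideEdges-blockSize (≤-<-trans ℓ≤k∸1 (∸-monoʳ-< z<s (≤-trans (s≤s z≤n) 3≤k))) ℓ>0
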